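{- For any integers $1\leq s\leq n$, $p_{n;\leq s}=p_{n,s;\leq s;n-s}$.
   Context: Given $m$ parking spaces in a line numbered $1,\dots,m$, $n$ cars arrive in order; car $j$ has preference $a_j$ and parks in the first unoccupied space numbered $\geq a_j$; if there is none, the car cannot park. A preference sequence is $k$-flaw if exactly $k$ cars cannot park, and a parking function if it is $0$-flaw. $p_{n,m;\leq s;k}$ is the number of $k$-flaw preference sequences of length $n$ with $m$ spaces and all $a_j\in[s]$; $p_{n;\leq s}=p_{n,n;\leq s;0}$ is the number of parking functions of length $n$ with $n$ spaces and all $a_j\leq s$. -}

module Defs where

open import Data.Nat using (ℕ; zero; suc; _+_; _∸_; _≟_)
open import Data.Bool using (Bool; true; false)
open import Data.List using (List; []; _∷_; map; concatMap; filter; length; replicate)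
open import Data.Product using (_×_; _,_; proj₁; proj₂)
open import Relation.Nullary.Decidable using (Dec)

-- A parking lot with m spaces is a list of m Booleans; position i (0-based)
-- is space i+1; true = occupied.

-- parkFrom i occ : car that prefers space i+1 (0-based index i) on lot occ.
-- Returns (new lot, whether the car parked).
-- It parks in the first unoccupied space with index ≥ i.
parkAt : ℕ → List Bool → List Bool × Bool
parkAt i       []            = [] , false
parkAt zero    (false ∷ occ) = true ∷ occ , true
parkAt zero    (true ∷ occ)  with parkAt zero occ
... | occ' , b = true ∷ occ' , b
parkAt (suc i) (x ∷ occ)     with parkAt i occ
... | occ' , b = x ∷ occ' , b

-- Car with preference a (a ≥ 1, 1-based) : index a ∸ 1.
-- Run cars in order, counting the cars that cannot park.
failures : List Bool → List ℕ → ℕ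
failures occ []       = 0
failures occ (a ∷ as) with parkAt (a ∸ 1) occ
... | occ' , true  = failures occ' as
... | occ' , false = suc (failures occ' as)

flaws : ℕ → List ℕ → ℕ
flaws m as = failures (replicate m false) as

range1 : ℕ → List ℕ
range1 zero    = []
range1 (suc s) = 1 ∷ map suc (range1 s)

prefSeqs : ℕ → ℕ → List (List ℕ)
prefSeqs zero    s = [] ∷ []
prefSeqs (suc n) s = concatMap (λ a → map (a ∷_) (prefSeqs n s)) (range1 s)

p : (n m s k : ℕ) → ℕ
p n m s k = length (filter (λ as → flaws m as ≟ k) (prefSeqs n s))

pPF : (n s : ℕ) → ℕ
pPF n s = p n n s 0

module Submission where

-- Let every preference lie in [s] and let the lot have n ≥ s
-- spaces.  Then a car never looks past space s unless it would fail on a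
-- lot of only s spaces; in that case it takes the first free space among
-- the extra n - s, if any is left.  Hence
--     flaws n as = flaws s as ∸ (n ∸ s).                         (1)
-- Moreover every car either parks or is turned away, so with n cars and s
-- spaces at least n - s cars are turned away:  n ∸ s ≤ flaws s as.  (2)
-- By (1) and (2), a sequence of length n is a parking function for n spaces
-- exactly when it is (n - s)-flaw for s spaces, and the two filters defining
-- p n n s 0 and p n s s (n ∸ s) select the same sequences.

open import Defs
open import Data.Nat using (ℕ; zero; suc; _+_; _∸_; _≤_; _<_; _≟_; z≤n; s≤s)
open import Data.Nat.Properties
  using ( +-suc; +-comm; +-assoc; <⇒≤; ≤-antisym; 0∸n≡0; n∸n≡0; m∸n≡0⇒m≤n
        ; m≤n+o⇒m∸n≤o; m+[n∸m]≡n; module ≤-Reasoning)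
open import Data.Bool using (Bool; true; false)
open import Data.List using (List; []; _∷_; _++_; map; filter; length; replicate)
open import Data.List.Properties using (filter-accept; filter-reject; length-replicate)
open import Data.List.Relation.Unary.All as All using (All; []; _∷_)
open import Data.List.Relation.Unary.All.Properties using (map⁺; concat⁺)
open import Data.Product using (_×_; _,_; proj₁; proj₂; map₁)
open import Function.Bundles using (_⇔_; mk⇔; Equivalence)
open import Relation.Nullary using (yes; no)
open import Level using (0ℓ)
open import Relation.Unary using (Pred; Decidable)
open import Relation.Binary.PropositionalEquality
  using (_≡_; refl; sym; trans; cong; subst; module ≡-Reasoning)

free : List Bool → ℕ
free []          = 0
free (false ∷ o) = suc (free o)
free (true ∷ o)  = free o

miss : Bool → ℕ
miss true  = 0
miss false = 1

parkAt-length : ∀ i occ → length (proj₁ (parkAt i occ)) ≡ length occ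
parkAt-length i       []            = refl
parkAt-length zero    (false ∷ occ) = refl
parkAt-length zero    (true ∷ occ)  = cong suc (parkAt-length zero occ)
parkAt-length (suc i) (x ∷ occ)     = cong suc (parkAt-length i occ)

parkAt-free : ∀ i occ →
  miss (proj₂ (parkAt i occ)) + free occ ≡ suc (free (proj₁ (parkAt i occ)))
parkAt-free i       []             = refl
parkAt-free zero    (false ∷ occ)  = refl
parkAt-free zero    (true ∷ occ)   = parkAt-free zero occ
parkAt-free (suc i) (true ∷ occ)   = parkAt-free i occ
parkAt-free (suc i) (false ∷ occ)  =
  trans (+-suc (miss (proj₂ (parkAt i occ))) (free occ)) (cong suc (parkAt-free i occ))

parkAt-++-parked : ∀ i occ rest → proj₂ (parkAt i occ) ≡ true →
  parkAt i (occ ++ rest) ≡ (proj₁ (parkAt i occ) ++ rest , true)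
parkAt-++-parked i       []            rest ()
parkAt-++-parked zero    (false ∷ occ) rest parked = refl
parkAt-++-parked zero    (true ∷ occ)  rest parked =
  cong (map₁ (true ∷_)) (parkAt-++-parked zero occ rest parked)
parkAt-++-parked (suc i) (x ∷ occ)     rest parked =
  cong (map₁ (x ∷_)) (parkAt-++-parked i occ rest parked)

parkAt-++-failed : ∀ i occ rest → i ≤ length occ → proj₂ (parkAt i occ) ≡ false →
  parkAt i (occ ++ rest) ≡
    (proj₁ (parkAt i occ) ++ proj₁ (parkAt 0 rest) , proj₂ (parkAt 0 rest))
parkAt-++-failed zero    []            rest i≤ failed = refl
parkAt-++-failed zero    (true ∷ occ)  rest i≤ failed =
  cong (map₁ (true ∷_)) (parkAt-++-failed zero occ rest z≤n failed)
parkAt-++-failed (suc i) (x ∷ occ)     rest (s≤s i≤) failed =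
  cong (map₁ (x ∷_)) (parkAt-++-failed i occ rest i≤ failed)

-- An overflowing car reduces a count f of earlier overflows still to be
-- absorbed by rest: it parks in rest if rest has room, else adds a flaw.
overflow : ∀ f rest →
  miss (proj₂ (parkAt 0 rest)) + (f ∸ free (proj₁ (parkAt 0 rest))) ≡ suc f ∸ free rest
overflow f []           = refl
overflow f (false ∷ r)  = refl
overflow f (true ∷ r)   = overflow f r

failures-cons : ∀ occ a as →
  failures occ (a ∷ as) ≡
    miss (proj₂ (parkAt (a ∸ 1) occ)) + failures (proj₁ (parkAt (a ∸ 1) occ)) as
failures-cons occ a as with parkAt (a ∸ 1) occ
... | occ' , true  = refl
... | occ' , false = refl

failures-++ : ∀ s occ rest as → length occ ≡ s → All (λ a → a ∸ 1 < s) as →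
  failures (occ ++ rest) as ≡ failures occ as ∸ free rest
failures-++ s occ rest []       len []         = sym (0∸n≡0 (free rest))
failures-++ s occ rest (a ∷ as) len (a<s ∷ as<s)
  rewrite failures-cons occ a as | failures-cons (occ ++ rest) a as
  with proj₂ (parkAt (a ∸ 1) occ) in outcome
... | true rewrite parkAt-++-parked (a ∸ 1) occ rest outcome =
  failures-++ s (proj₁ (parkAt (a ∸ 1) occ)) rest as
    (trans (parkAt-length (a ∸ 1) occ) len) as<s
... | false rewrite parkAt-++-failed (a ∸ 1) occ rest
                     (subst (a ∸ 1 ≤_) (sym len) (<⇒≤ a<s)) outcome =
  trans (cong (miss (proj₂ (parkAt 0 rest)) +_)
              (failures-++ s occ' (proj₁ (parkAt 0 rest)) as len' as<s))
        (overflow (failures occ' as) rest)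
  where
  occ' : List Bool
  occ' = proj₁ (parkAt (a ∸ 1) occ)
  len' : length occ' ≡ s
  len' = trans (parkAt-length (a ∸ 1) occ) len

-- Every car either parks in a free space or counts as a flaw.
failures-lower-bound : ∀ occ as → length as ≤ failures occ as + free occ
failures-lower-bound occ []       = z≤n
failures-lower-bound occ (a ∷ as) = begin
  suc (length as)                                 ≤⟨ s≤s (failures-lower-bound occ' as) ⟩
  suc (failures occ' as + free occ')              ≡⟨ sym (+-suc (failures occ' as) (free occ')) ⟩
  failures occ' as + suc (free occ')              ≡⟨ cong (failures occ' as +_) (sym (parkAt-free (a ∸ 1) occ)) ⟩
  failures occ' as + (miss parked + free occ)     ≡⟨ sym (+-assoc (failures occ' as) (miss parked) (free occ)) ⟩
  failures occ' as + miss parked + free occ       ≡⟨ cong (_+ free occ) (+-comm (failures occ' as) (miss parked)) ⟩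
  miss parked + failures occ' as + free occ       ≡⟨ cong (_+ free occ) (sym (failures-cons occ a as)) ⟩
  failures occ (a ∷ as) + free occ                ∎
  where
  open ≤-Reasoning
  occ' : List Bool
  occ' = proj₁ (parkAt (a ∸ 1) occ)
  parked : Bool
  parked = proj₂ (parkAt (a ∸ 1) occ)

replicate-+ : ∀ {A : Set} m k (x : A) → replicate (m + k) x ≡ replicate m x ++ replicate k x
replicate-+ zero    k x = refl
replicate-+ (suc m) k x = cong (x ∷_) (replicate-+ m k x)

free-empty : ∀ s → free (replicate s false) ≡ s
free-empty zero    = refl
free-empty (suc s) = cong suc (free-empty s)

flaws-extra-spaces : ∀ n s as → s ≤ n → All (λ a → a ∸ 1 < s) as →
  flaws n as ≡ flaws s as ∸ (n ∸ s)
flaws-extra-spaces n s as s≤n as<s = begin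
  failures (replicate n false) as
    ≡⟨ cong (λ m → failures (replicate m false) as) (sym (m+[n∸m]≡n s≤n)) ⟩
  failures (replicate (s + (n ∸ s)) false) as
    ≡⟨ cong (λ lot → failures lot as) (replicate-+ s (n ∸ s) false) ⟩
  failures (replicate s false ++ replicate (n ∸ s) false) as
    ≡⟨ failures-++ s (replicate s false) _ as (length-replicate s) as<s ⟩
  flaws s as ∸ free (replicate (n ∸ s) false)
    ≡⟨ cong (flaws s as ∸_) (free-empty (n ∸ s)) ⟩
  flaws s as ∸ (n ∸ s) ∎
  where open ≡-Reasoning

flaws-lower-bound : ∀ n s as → length as ≡ n → n ∸ s ≤ flaws s as
flaws-lower-bound n s as len = m≤n+o⇒m∸n≤o n s (begin
  n                                    ≡⟨ sym len ⟩
  length as                            ≤⟨ failures-lower-bound (replicate s false) as ⟩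
  flaws s as + free (replicate s false) ≡⟨ cong (flaws s as +_) (free-empty s) ⟩
  flaws s as + s                       ≡⟨ +-comm (flaws s as) s ⟩
  s + flaws s as                       ∎)
  where open ≤-Reasoning

Admissible : ℕ → ℕ → List ℕ → Set
Admissible n s as = length as ≡ n × All (λ a → a ∸ 1 < s) as

range1-index : ∀ s → All (λ a → a ∸ 1 < s) (range1 s)
range1-index zero    = []
range1-index (suc s) = s≤s z≤n ∷ map⁺ {P = λ a → a ∸ 1 < suc s} (All.map shift (range1-index s))
  where
  shift : ∀ {a} → a ∸ 1 < s → suc a ∸ 1 < suc s
  shift {zero}  _   = s≤s z≤n
  shift {suc a} a<s = s≤s a<s

prefSeqs-admissible : ∀ n s → All (Admissible n s) (prefSeqs n s)
prefSeqs-admissible zero    s = (refl , []) ∷ []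
prefSeqs-admissible (suc n) s = concat⁺ (map⁺ (All.map extend (range1-index s)))
  where
  extend : ∀ {a} → a ∸ 1 < s → All (Admissible (suc n) s) (map (a ∷_) (prefSeqs n s))
  extend a<s = map⁺ (All.map (λ (len , as<s) → cong suc len , a<s ∷ as<s)
                             (prefSeqs-admissible n s))

filter-cong : ∀ {A : Set} {P Q : Pred A 0ℓ} (P? : Decidable P) (Q? : Decidable Q) {xs} →
  All (λ x → P x ⇔ Q x) xs → filter P? xs ≡ filter Q? xs
filter-cong P? Q? []                      = refl
filter-cong P? Q? {x ∷ xs} (P⇔Q ∷ agree) with P? x
... | yes Px = trans (cong (x ∷_) (filter-cong P? Q? agree))
                     (sym (filter-accept Q? (Equivalence.to P⇔Q Px)))
... | no ¬Px = trans (filter-cong P? Q? agree)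
                     (sym (filter-reject Q? (λ Qx → ¬Px (Equivalence.from P⇔Q Qx))))

∸≡0⇔≡ : ∀ {m k} → k ≤ m → (m ∸ k ≡ 0 ⇔ m ≡ k)
∸≡0⇔≡ {m} k≤m = mk⇔ (λ m∸k≡0 → ≤-antisym (m∸n≡0⇒m≤n m∸k≡0) k≤m) (λ { refl → n∸n≡0 m })

lemma2p5 : (n s : ℕ) → 1 ≤ s → s ≤ n → pPF n s ≡ p n s s (n ∸ s)
lemma2p5 n s _ s≤n =
  cong length (filter-cong (λ as → flaws n as ≟ 0) (λ as → flaws s as ≟ n ∸ s)
                           (All.map same-selection (prefSeqs-admissible n s)))
  where
  same-selection : ∀ {as} → Admissible n s as → (flaws n as ≡ 0 ⇔ flaws s as ≡ n ∸ s)
  same-selection {as} (len , as<s) rewrite flaws-extra-spaces n s as s≤n as<s =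
    ∸≡0⇔≡ (flaws-lower-bound n s as len)
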